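{- Let $p\in(0,1)$, $\theta>0$, and $\varepsilon\leq\theta/3$. Suppose the edges of $K_N$ with vertex set $V$ are red/blue colored and there is a partition $V=A_1\sqcup\cdots\sqcup A_\ell\sqcup A_{\ell+1}$ such that $(A_i,V)$ is $(p,\varepsilon)$-regular in blue for each $1\leq i\leq\ell$ and $|A_{\ell+1}|\leq\varepsilon N$. Then the coloring is $(p,\theta)$-quasirandom.
   Context: For vertex sets $X,Y$ (not necessarily disjoint), $d_B(X,Y)$ is the number of pairs in $X\times Y$ that are blue edges divided by $|X||Y|$. $(X,Y)$ is $(p,\varepsilon)$-regular in blue if $|d_B(X',Y')-p|\leq\varepsilon$ for all $X'\subseteq X$, $Y'\subseteq Y$ with $|X'|\geq\varepsilon|X|$, $|Y'|\geq\varepsilon|Y|$. The coloring is $(p,\theta)$-quasirandom if for every pair of disjoint $X,Y\subseteq V$, $|e_B(X,Y)-p|X||Y||\leq\theta N^2$, where $e_B(X,Y)$ is the number of blue edges between $X$ and $Y$. -}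

module Defs where

open import Data.Nat using (ℕ; zero; suc)
import Data.Nat
open import Data.Integer using (+_)
open import Data.Rational using (ℚ; _/_; _*_; _-_; _≤_)
open import Data.Rational as Q using ()
open import Data.Bool using (Bool; true; false; if_then_else_; _∧_; not)
open import Data.Fin using (Fin; _≟_)
open import Data.Fin.Subset using (Subset; _∈_; _∉_; _⊆_; ∣_∣)
open import Data.Vec using (lookup)
open import Data.List using (map; allFin)
open import Data.Nat.ListAction using (sum)
open import Data.Product using (_×_; ∃)
open import Data.Sum using (_⊎_)
open import Relation.Nullary.Decidable using (⌊_⌋)
open import Relation.Binary.PropositionalEquality using (_≡_)

ℕ→ℚ : ℕ → ℚ
ℕ→ℚ n = + n / 1

-- A red/blue colouring of the edges of K_N on vertex set Fin N:
-- `c x y ≡ true` means the edge {x,y} (x ≢ y) is blue, otherwise red.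
-- Symmetry is required as a hypothesis (edges are unordered); the values
-- c x x are irrelevant since loops are not edges.
Coloring : ℕ → Set
Coloring N = Fin N → Fin N → Bool

Symmetric : ∀ {N} → Coloring N → Set
Symmetric {N} c = (x y : Fin N) → c x y ≡ c y x

blueInd : ∀ {N} → Coloring N → Subset N → Subset N → Fin N → Fin N → ℕ
blueInd c X Y x y =
  if lookup X x ∧ lookup Y y ∧ not ⌊ x ≟ y ⌋ ∧ c x y then 1 else 0

-- number of pairs in X × Y that are blue edges (X, Y not necessarily disjoint);
-- for disjoint X, Y this is e_B(X,Y).
eB : ∀ {N} → Coloring N → Subset N → Subset N → ℕ
eB {N} c X Y = sum (map (λ x → sum (map (λ y → blueInd c X Y x y) (allFin N))) (allFin N))

-- (X,Y) is (p,ε)-regular in blue: for all X' ⊆ X, Y' ⊆ Y with |X'| ≥ ε|X|,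
-- |Y'| ≥ ε|Y|, we have |d_B(X',Y') - p| ≤ ε, where d_B(X',Y') = eB/(|X'||Y'|).
-- Stated multiplied through by |X'||Y'| to avoid division (equivalent when
-- X', Y' are nonempty; vacuous for the undefined 0/0 case).
RegularBlue : ∀ {N} → Coloring N → ℚ → ℚ → Subset N → Subset N → Set
RegularBlue c p ε X Y =
  ∀ X' Y' → X' ⊆ X → Y' ⊆ Y →
  ε * ℕ→ℚ ∣ X ∣ ≤ ℕ→ℚ ∣ X' ∣ → ε * ℕ→ℚ ∣ Y ∣ ≤ ℕ→ℚ ∣ Y' ∣ →
  Q.∣ ℕ→ℚ (eB c X' Y') - p * ℕ→ℚ (∣ X' ∣ Data.Nat.* ∣ Y' ∣) ∣
    ≤ ε * ℕ→ℚ (∣ X' ∣ Data.Nat.* ∣ Y' ∣)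

Disjoint : ∀ {N} → Subset N → Subset N → Set
Disjoint {N} X Y = (v : Fin N) → v ∈ X → v ∉ Y

Quasirandom : ∀ {N} → Coloring N → ℚ → ℚ → Set
Quasirandom {N} c p θ =
  ∀ X Y → Disjoint X Y →
  Q.∣ ℕ→ℚ (eB c X Y) - p * ℕ→ℚ (∣ X ∣ Data.Nat.* ∣ Y ∣) ∣ ≤ θ * ℕ→ℚ (N Data.Nat.* N)

-- V = A_1 ⊔ ... ⊔ A_ℓ ⊔ E  (E plays the role of A_{ℓ+1}); parts may be empty.
IsPartition : ∀ {N ℓ} → (Fin ℓ → Subset N) → Subset N → Set
IsPartition {N} {ℓ} A E =
  ((i j : Fin ℓ) (v : Fin N) → v ∈ A i → v ∈ A j → i ≡ j) ×
  ((i : Fin ℓ) (v : Fin N) → v ∈ A i → v ∉ E) ×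
  ((v : Fin N) → v ∈ E ⊎ ∃ λ i → v ∈ A i)

{-# OPTIONS --safe #-}
-- Split X along the partition. On a part A i, either X ∩ A i and Y are large enough
-- (|X ∩ A i| ≥ ε|A i| and |Y| ≥ εN) for the regularity of (A i, V) to bound the
-- discrepancy of (X ∩ A i, Y) by ε|X ∩ A i||Y| ≤ εN|X ∩ A i|, or one of them is small
-- and the trivial bound |X ∩ A i||Y| is at most εN|A i| or εN|X ∩ A i|. Summing over i
-- gives at most εN(|X| + N) ≤ 2εN², the exceptional part E contributes at most
-- |E|N ≤ εN², and 3εN² ≤ θN².
module Submission where

open import Defs
open import Data.Nat using (ℕ)
open import Data.Fin using (Fin)
open import Data.Fin.Subset using (Subset; ⊤; ∣_∣)
open import Data.Integer using (+_)
open import Data.Rational using (ℚ; _/_; _*_; _<_; _≤_; 0ℚ; 1ℚ)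

open import Algebra.Bundles using (Ring)
open import Data.Bool using (Bool; true; false; if_then_else_; _∧_; not)
open import Data.Bool.Properties using (¬-not)
open import Data.Fin using (zero; suc; _≟_; punchIn)
open import Data.Fin.Properties using (punchInᵢ≢i)
open import Data.Fin.Subset using (_∩_; _∉_)
import Data.Fin.Subset.Properties as Subsetₚ
import Data.Integer as ℤ
import Data.Integer.Properties as ℤₚ
import Data.List as List
import Data.List.Properties as Listₚ
import Data.Nat as ℕ
import Data.Nat.Coprimality as Coprimality
import Data.Nat.ListAction as ListAction
import Data.Nat.Properties as ℕₚ
open import Data.Product using (_,_; proj₁; proj₂)
import Data.Rational as Q
open import Data.Rational using (_+_; _-_; -_; mkℚ; NonNegative; nonNegative; *≤*)
open import Data.Rational.Properties
  using ( normalize-coprime; normalize-nonNeg; normalize-pos; +-*-ring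
        ; ≤-refl; ≤-trans; <⇒≤; ≰⇒>; _≤?_; module ≤-Reasoning
        ; +-identityʳ; *-identityˡ; *-identityʳ; *-zeroˡ; *-zeroʳ; *-comm; *-distribˡ-+
        ; +-mono-≤; +-monoʳ-≤; neg-antimono-≤; *-monoˡ-≤-nonNeg; *-monoʳ-≤-nonNeg; *-cancelʳ-≤-pos
        ; nonNegative⁻¹; nonNeg*nonNeg⇒nonNeg; ∣p∣≡p∨∣p∣≡-p; ∣p+q∣≤∣p∣+∣q∣ )
open import Data.Rational.Solver using (module +-*-Solver)
open import Data.Sum using (inj₁; inj₂)
open import Data.Vec using ([]; _∷_; lookup)
open import Data.Vec.Properties using (lookup-zipWith; lookup⇒[]=; []=⇒lookup)
open import Function using (_∘_; id)
open import Relation.Binary.PropositionalEquality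
open import Relation.Nullary using (Dec; yes; no)
open import Relation.Nullary.Decidable using (⌊_⌋)

open import Algebra.Properties.Semiring.Sum ℕₚ.+-*-semiring
  using (sum; sum-syntax; sum-cong-≗; sum-replicate-zero; sum-remove; ∑-distrib-+; ∑-comm; *-distribʳ-sum)
open import Algebra.Properties.Semiring.Sum (Ring.semiring +-*-ring)
  using () renaming (sum to ∑ℚ; *-distribˡ-sum to *-distribˡ-∑ℚ)

private
  variable
    N ℓ : ℕ

∑-allFin : ∀ n (f : Fin n → ℕ) → ListAction.sum (List.map f (List.allFin n)) ≡ ∑[ i < n ] f i
∑-allFin n f = trans (cong ListAction.sum (Listₚ.map-tabulate id f)) (∑-tabulate n f)
  where
  ∑-tabulate : ∀ n (f : Fin n → ℕ) → ListAction.sum (List.tabulate f) ≡ ∑[ i < n ] f i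
  ∑-tabulate ℕ.zero    f = refl
  ∑-tabulate (ℕ.suc n) f = cong (f zero ℕ.+_) (∑-tabulate n (f ∘ suc))

∑-≡0 : ∀ {n} (f : Fin n → ℕ) → (∀ i → f i ≡ 0) → ∑[ i < n ] f i ≡ 0
∑-≡0 {n} f f≡0 = trans (sum-cong-≗ f≡0) (sum-replicate-zero n)

∑-single : ∀ {n} (f : Fin n → ℕ) j → (∀ i → i ≢ j → f i ≡ 0) → ∑[ i < n ] f i ≡ f j
∑-single {ℕ.suc n} f j f≡0 = begin
  sum f                        ≡⟨ sum-remove {i = j} f ⟩
  f j ℕ.+ sum (f ∘ punchIn j)  ≡⟨ cong (f j ℕ.+_) (∑-≡0 _ (λ k → f≡0 _ (punchInᵢ≢i j k))) ⟩
  f j ℕ.+ 0                    ≡⟨ ℕₚ.+-identityʳ (f j) ⟩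
  f j                          ∎
  where open ≡-Reasoning

∑-mono-≤ : ∀ {n} {f g : Fin n → ℕ} → (∀ i → f i ℕ.≤ g i) → ∑[ i < n ] f i ℕ.≤ ∑[ i < n ] g i
∑-mono-≤ {ℕ.zero}  f≤g = ℕ.z≤n
∑-mono-≤ {ℕ.suc n} f≤g = ℕₚ.+-mono-≤ (f≤g zero) (∑-mono-≤ (f≤g ∘ suc))

when : Bool → ℕ → ℕ
when b v = if b then v else 0

when-∧ : ∀ a b v → when (a ∧ b) v ≡ when a (when b v)
when-∧ true  b v = refl
when-∧ false b v = refl

when-+ : ∀ b u v → when b (u ℕ.+ v) ≡ when b u ℕ.+ when b v
when-+ true  u v = refl
when-+ false u v = refl

when-≤ : ∀ b v → when b v ℕ.≤ v
when-≤ true  v = ℕₚ.≤-refl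
when-≤ false v = ℕ.z≤n

when-mono-≤ : ∀ b {u v} → u ℕ.≤ v → when b u ℕ.≤ when b v
when-mono-≤ true  u≤v = u≤v
when-mono-≤ false u≤v = ℕ.z≤n

∑-when : ∀ {n} b (f : Fin n → ℕ) → ∑[ i < n ] when b (f i) ≡ when b (∑[ i < n ] f i)
∑-when {n} true  f = refl
∑-when {n} false f = sum-replicate-zero n

sum∈ : Subset N → (Fin N → ℕ) → ℕ
sum∈ {N} X w = ∑[ x < N ] when (lookup X x) (w x)

syntax sum∈ X (λ x → w) = ∑[ x ∈ X ] w

∑∈-const : (X : Subset N) (k : ℕ) → ∑[ x ∈ X ] k ≡ ∣ X ∣ ℕ.* k
∑∈-const []          k = refl
∑∈-const (true ∷ X)  k = cong (k ℕ.+_) (∑∈-const X k)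
∑∈-const (false ∷ X) k = ∑∈-const X k

card≡∑∈1 : (X : Subset N) → ∣ X ∣ ≡ ∑[ x ∈ X ] 1
card≡∑∈1 X = sym (trans (∑∈-const X 1) (ℕₚ.*-identityʳ ∣ X ∣))

∑∈-mono-≤ : (X : Subset N) {u v : Fin N → ℕ} → (∀ x → u x ℕ.≤ v x) →
            ∑[ x ∈ X ] u x ℕ.≤ ∑[ x ∈ X ] v x
∑∈-mono-≤ X u≤v = ∑-mono-≤ (λ x → when-mono-≤ (lookup X x) (u≤v x))

when-∩ : (X B : Subset N) → ∀ x v →
         when (lookup (X ∩ B) x) v ≡ when (lookup X x) (when (lookup B x) v)
when-∩ X B x v = trans (cong (λ b → when b v) (lookup-zipWith _∧_ x X B))
                       (when-∧ (lookup X x) (lookup B x) v)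

∉⇒lookup≡false : ∀ {x : Fin N} {B : Subset N} → x ∉ B → lookup B x ≡ false
∉⇒lookup≡false {x = x} {B} x∉B = ¬-not (x∉B ∘ lookup⇒[]= x B)

blueEdge : Coloring N → Fin N → Fin N → ℕ
blueEdge c x y = when (not ⌊ x ≟ y ⌋ ∧ c x y) 1

eB≡∑∈∑∈blueEdge : (c : Coloring N) (X Y : Subset N) →
                  eB c X Y ≡ ∑[ x ∈ X ] ∑[ y ∈ Y ] blueEdge c x y
eB≡∑∈∑∈blueEdge {N} c X Y = trans (∑-allFin N _) (sum-cong-≗ (λ x → trans (∑-allFin N _) (row x)))
  where
  row : ∀ x → ∑[ y < N ] blueInd c X Y x y ≡ when (lookup X x) (∑[ y ∈ Y ] blueEdge c x y)
  row x = trans (sum-cong-≗ (λ y → trans (when-∧ (lookup X x) _ 1)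
                                         (cong (when (lookup X x)) (when-∧ (lookup Y y) _ 1))))
                (∑-when (lookup X x) (λ y → when (lookup Y y) (blueEdge c x y)))

eB≤∣X∣*∣Y∣ : (c : Coloring N) (X Y : Subset N) → eB c X Y ℕ.≤ ∣ X ∣ ℕ.* ∣ Y ∣
eB≤∣X∣*∣Y∣ c X Y = begin
  eB c X Y                              ≡⟨ eB≡∑∈∑∈blueEdge c X Y ⟩
  ∑[ x ∈ X ] ∑[ y ∈ Y ] blueEdge c x y  ≤⟨ ∑∈-mono-≤ X (λ x → ∑∈-mono-≤ Y (λ y → when-≤ _ 1)) ⟩
  ∑[ x ∈ X ] ∑[ y ∈ Y ] 1               ≡⟨ cong (λ k → ∑[ x ∈ X ] k) (card≡∑∈1 Y) ⟨
  ∑[ x ∈ X ] ∣ Y ∣                      ≡⟨ ∑∈-const X ∣ Y ∣ ⟩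
  ∣ X ∣ ℕ.* ∣ Y ∣                       ∎
  where open ℕₚ.≤-Reasoning

ℕ→ℚ≡mkℚ : ∀ n → ℕ→ℚ n ≡ mkℚ (+ n) 0 (Coprimality.sym (Coprimality.1-coprimeTo n))
ℕ→ℚ≡mkℚ n = normalize-coprime (Coprimality.sym (Coprimality.1-coprimeTo n))

ℕ→ℚ-+ : ∀ m n → ℕ→ℚ (m ℕ.+ n) ≡ ℕ→ℚ m + ℕ→ℚ n
ℕ→ℚ-+ m n = begin
  + (m ℕ.+ n) / 1                    ≡⟨ cong₂ (λ a b → (a ℤ.+ b) / 1) (ℤₚ.*-identityʳ (+ m))
                                                                      (ℤₚ.*-identityʳ (+ n)) ⟨
  (+ m ℤ.* + 1 ℤ.+ + n ℤ.* + 1) / 1  ≡⟨ cong₂ _+_ (ℕ→ℚ≡mkℚ m) (ℕ→ℚ≡mkℚ n) ⟨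
  ℕ→ℚ m + ℕ→ℚ n                      ∎
  where open ≡-Reasoning

ℕ→ℚ-* : ∀ m n → ℕ→ℚ (m ℕ.* n) ≡ ℕ→ℚ m * ℕ→ℚ n
ℕ→ℚ-* m n = begin
  + (m ℕ.* n) / 1    ≡⟨ cong (_/ 1) (ℤₚ.pos-* m n) ⟩
  (+ m ℤ.* + n) / 1  ≡⟨ cong₂ _*_ (ℕ→ℚ≡mkℚ m) (ℕ→ℚ≡mkℚ n) ⟨
  ℕ→ℚ m * ℕ→ℚ n      ∎
  where open ≡-Reasoning

ℕ→ℚ-mono-≤ : ∀ {m n} → m ℕ.≤ n → ℕ→ℚ m ≤ ℕ→ℚ n
ℕ→ℚ-mono-≤ {m} {n} m≤n rewrite ℕ→ℚ≡mkℚ m | ℕ→ℚ≡mkℚ n =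
  *≤* (subst₂ ℤ._≤_ (sym (ℤₚ.*-identityʳ (+ m))) (sym (ℤₚ.*-identityʳ (+ n))) (ℤ.+≤+ m≤n))

ℕ→ℚ-nonNeg : ∀ n → NonNegative (ℕ→ℚ n)
ℕ→ℚ-nonNeg n = normalize-nonNeg n 1

0≤ℕ→ℚ : ∀ n → 0ℚ ≤ ℕ→ℚ n
0≤ℕ→ℚ n = ℕ→ℚ-mono-≤ {0} {n} ℕ.z≤n

ℕ→ℚ-∑ : ∀ {n} (f : Fin n → ℕ) → ℕ→ℚ (∑[ i < n ] f i) ≡ ∑ℚ (λ i → ℕ→ℚ (f i))
ℕ→ℚ-∑ {ℕ.zero}  f = refl
ℕ→ℚ-∑ {ℕ.suc n} f = trans (ℕ→ℚ-+ (f zero) _) (cong (_+_ (ℕ→ℚ (f zero))) (ℕ→ℚ-∑ (f ∘ suc)))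

∣∑ℚ∣≤ : ∀ {n} (f g : Fin n → ℚ) → (∀ i → Q.∣ f i ∣ ≤ g i) → Q.∣ ∑ℚ f ∣ ≤ ∑ℚ g
∣∑ℚ∣≤ {ℕ.zero}  f g ∣f∣≤g = ≤-refl
∣∑ℚ∣≤ {ℕ.suc n} f g ∣f∣≤g = ≤-trans (∣p+q∣≤∣p∣+∣q∣ (f zero) (∑ℚ (f ∘ suc)))
  (+-mono-≤ (∣f∣≤g zero) (∣∑ℚ∣≤ (f ∘ suc) (g ∘ suc) (∣f∣≤g ∘ suc)))

∑ℚ-*ℕ→ℚ : ∀ {n} r (k : Fin n → ℕ) m →
           ∑ℚ (λ i → r * ℕ→ℚ (k i)) + r * ℕ→ℚ m ≡ r * ℕ→ℚ (∑[ i < n ] k i ℕ.+ m)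
∑ℚ-*ℕ→ℚ {n} r k m = begin
  ∑ℚ (λ i → r * K i) + r * ℕ→ℚ m      ≡⟨ cong (_+ r * ℕ→ℚ m) (*-distribˡ-∑ℚ r K) ⟨
  r * ∑ℚ K + r * ℕ→ℚ m                ≡⟨ *-distribˡ-+ r (∑ℚ K) (ℕ→ℚ m) ⟨
  r * (∑ℚ K + ℕ→ℚ m)                  ≡⟨ cong (λ s → r * (s + ℕ→ℚ m)) (ℕ→ℚ-∑ k) ⟨
  r * (ℕ→ℚ (∑[ i < n ] k i) + ℕ→ℚ m)  ≡⟨ cong (r *_) (ℕ→ℚ-+ (∑[ i < n ] k i) m) ⟨
  r * ℕ→ℚ (∑[ i < n ] k i ℕ.+ m)      ∎
  where
  open ≡-Reasoning
  K : Fin n → ℚ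
  K i = ℕ→ℚ (k i)

p-q≤p : ∀ p {q} → 0ℚ ≤ q → p - q ≤ p
p-q≤p p {q} 0≤q = subst (p - q ≤_) (+-identityʳ p) (+-monoʳ-≤ p (neg-antimono-≤ 0≤q))

p≤q⇒-p≤q⇒∣p∣≤q : ∀ {p q} → p ≤ q → - p ≤ q → Q.∣ p ∣ ≤ q
p≤q⇒-p≤q⇒∣p∣≤q {p} p≤q -p≤q with ∣p∣≡p∨∣p∣≡-p p
... | inj₁ ∣p∣≡p  = subst (_≤ _) (sym ∣p∣≡p) p≤q
... | inj₂ ∣p∣≡-p = subst (_≤ _) (sym ∣p∣≡-p) -p≤q

ε≤θ/3⇒ε+ε+ε≤θ : ∀ {ε θ} → ε ≤ θ * (+ 1 / 3) → ε + ε + ε ≤ θ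
ε≤θ/3⇒ε+ε+ε≤θ {ε} {θ} ε≤θ/3 = begin
  ε + ε + ε                                      ≤⟨ +-mono-≤ (+-mono-≤ ε≤θ/3 ε≤θ/3) ε≤θ/3 ⟩
  θ * (+ 1 / 3) + θ * (+ 1 / 3) + θ * (+ 1 / 3)  ≡⟨ solve 2 (λ θ t → θ :* t :+ θ :* t :+ θ :* t
                                                                 := θ :* (t :+ t :+ t)) refl θ (+ 1 / 3) ⟩
  θ * 1ℚ                                         ≡⟨ *-identityʳ θ ⟩
  θ                                              ∎
  where
  open ≤-Reasoning
  open +-*-Solver

deviation : ℚ → ℕ → ℕ → ℚ
deviation p e m = ℕ→ℚ e - p * ℕ→ℚ m

∣deviation∣≤ : ∀ {p} e m → 0ℚ ≤ p → p ≤ 1ℚ → e ℕ.≤ m → Q.∣ deviation p e m ∣ ≤ ℕ→ℚ m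
∣deviation∣≤ {p} e m 0≤p p≤1 e≤m = p≤q⇒-p≤q⇒∣p∣≤q
  (≤-trans (p-q≤p (ℕ→ℚ e) 0≤pm) (ℕ→ℚ-mono-≤ e≤m))
  (begin
    - (ℕ→ℚ e - p * ℕ→ℚ m)  ≡⟨ solve 3 (λ e p m → :- (e :- p :* m) := p :* m :- e) refl
                                  (ℕ→ℚ e) p (ℕ→ℚ m) ⟩
    p * ℕ→ℚ m - ℕ→ℚ e      ≤⟨ p-q≤p (p * ℕ→ℚ m) (0≤ℕ→ℚ e) ⟩
    p * ℕ→ℚ m              ≤⟨ *-monoʳ-≤-nonNeg (ℕ→ℚ m) {{ℕ→ℚ-nonNeg m}} p≤1 ⟩
    1ℚ * ℕ→ℚ m             ≡⟨ *-identityˡ (ℕ→ℚ m) ⟩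
    ℕ→ℚ m                  ∎)
  where
  open ≤-Reasoning
  open +-*-Solver
  0≤pm : 0ℚ ≤ p * ℕ→ℚ m
  0≤pm = nonNegative⁻¹ _ {{nonNeg*nonNeg⇒nonNeg p {{nonNegative 0≤p}} (ℕ→ℚ m) {{ℕ→ℚ-nonNeg m}}}}

deviation-+ : ∀ p a b m n → deviation p (a ℕ.+ b) (m ℕ.+ n) ≡ deviation p a m + deviation p b n
deviation-+ p a b m n rewrite ℕ→ℚ-+ a b | ℕ→ℚ-+ m n =
  solve 5 (λ p a b m n → (a :+ b) :- p :* (m :+ n) := (a :- p :* m) :+ (b :- p :* n)) refl
    p (ℕ→ℚ a) (ℕ→ℚ b) (ℕ→ℚ m) (ℕ→ℚ n)
  where open +-*-Solver

deviation-∑ : ∀ p {n} (e m : Fin n → ℕ) →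
              deviation p (∑[ i < n ] e i) (∑[ i < n ] m i) ≡ ∑ℚ (λ i → deviation p (e i) (m i))
deviation-∑ p {ℕ.zero}  e m = cong (_-_ 0ℚ) (*-zeroʳ p)
deviation-∑ p {ℕ.suc n} e m = trans (deviation-+ p (e zero) _ (m zero) _)
  (cong (_+_ (deviation p (e zero) (m zero))) (deviation-∑ p (e ∘ suc) (m ∘ suc)))

regular-or-small⇒≤εN[x+a] : ∀ {ε d} x y a N → 0ℚ ≤ ε → y ℕ.≤ N →
  Q.∣ d ∣ ≤ ℕ→ℚ (x ℕ.* y) →
  (ε * ℕ→ℚ a ≤ ℕ→ℚ x → ε * ℕ→ℚ N ≤ ℕ→ℚ y → Q.∣ d ∣ ≤ ε * ℕ→ℚ (x ℕ.* y)) →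
  Q.∣ d ∣ ≤ ε * ℕ→ℚ N * ℕ→ℚ (x ℕ.+ a)
regular-or-small⇒≤εN[x+a] {ε} {d} x y a N 0≤ε y≤N trivial regular =
  bound (ε * ℕ→ℚ a ≤? ℕ→ℚ x) (ε * n ≤? ℕ→ℚ y)
  where
  open ≤-Reasoning
  open +-*-Solver
  n : ℚ
  n = ℕ→ℚ N
  instance
    ε-nonNeg : NonNegative ε
    ε-nonNeg = nonNegative 0≤ε
    x-nonNeg : NonNegative (ℕ→ℚ x)
    x-nonNeg = ℕ→ℚ-nonNeg x
    n-nonNeg : NonNegative n
    n-nonNeg = ℕ→ℚ-nonNeg N
    εn-nonNeg : NonNegative (ε * n)
    εn-nonNeg = nonNeg*nonNeg⇒nonNeg ε n

  y≤n : ℕ→ℚ y ≤ n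
  y≤n = ℕ→ℚ-mono-≤ y≤N

  scaled : ∀ {k} → k ℕ.≤ x ℕ.+ a → ε * n * ℕ→ℚ k ≤ ε * n * ℕ→ℚ (x ℕ.+ a)
  scaled k≤x+a = *-monoˡ-≤-nonNeg (ε * n) (ℕ→ℚ-mono-≤ k≤x+a)

  bound : Dec (ε * ℕ→ℚ a ≤ ℕ→ℚ x) → Dec (ε * n ≤ ℕ→ℚ y) →
          Q.∣ d ∣ ≤ ε * n * ℕ→ℚ (x ℕ.+ a)
  bound (yes large-x) (yes large-y) = begin
    Q.∣ d ∣                ≤⟨ regular large-x large-y ⟩
    ε * ℕ→ℚ (x ℕ.* y)      ≡⟨ cong (ε *_) (ℕ→ℚ-* x y) ⟩
    ε * (ℕ→ℚ x * ℕ→ℚ y)    ≤⟨ *-monoˡ-≤-nonNeg ε (*-monoˡ-≤-nonNeg (ℕ→ℚ x) y≤n) ⟩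
    ε * (ℕ→ℚ x * n)        ≡⟨ solve 3 (λ ε x n → ε :* (x :* n) := ε :* n :* x) refl ε (ℕ→ℚ x) n ⟩
    ε * n * ℕ→ℚ x          ≤⟨ scaled (ℕₚ.m≤m+n x a) ⟩
    ε * n * ℕ→ℚ (x ℕ.+ a)  ∎
  bound (no small-x) _ = begin
    Q.∣ d ∣                ≤⟨ trivial ⟩
    ℕ→ℚ (x ℕ.* y)          ≡⟨ ℕ→ℚ-* x y ⟩
    ℕ→ℚ x * ℕ→ℚ y          ≤⟨ *-monoˡ-≤-nonNeg (ℕ→ℚ x) y≤n ⟩
    ℕ→ℚ x * n              ≤⟨ *-monoʳ-≤-nonNeg n (<⇒≤ (≰⇒> small-x)) ⟩
    ε * ℕ→ℚ a * n          ≡⟨ solve 3 (λ ε a n → ε :* a :* n := ε :* n :* a) refl ε (ℕ→ℚ a) n ⟩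
    ε * n * ℕ→ℚ a          ≤⟨ scaled (ℕₚ.m≤n+m a x) ⟩
    ε * n * ℕ→ℚ (x ℕ.+ a)  ∎
  bound (yes _) (no small-y) = begin
    Q.∣ d ∣                ≤⟨ trivial ⟩
    ℕ→ℚ (x ℕ.* y)          ≡⟨ ℕ→ℚ-* x y ⟩
    ℕ→ℚ x * ℕ→ℚ y          ≤⟨ *-monoˡ-≤-nonNeg (ℕ→ℚ x) (<⇒≤ (≰⇒> small-y)) ⟩
    ℕ→ℚ x * (ε * n)        ≡⟨ *-comm (ℕ→ℚ x) (ε * n) ⟩
    ε * n * ℕ→ℚ x          ≤⟨ scaled (ℕₚ.m≤m+n x a) ⟩
    ε * n * ℕ→ℚ (x ℕ.+ a)  ∎

discrepancy : Coloring N → ℚ → Subset N → Subset N → ℚ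
discrepancy c p X Y = deviation p (eB c X Y) (∣ X ∣ ℕ.* ∣ Y ∣)

∣discrepancy∣≤∣X∣*∣Y∣ : ∀ {c : Coloring N} {p} → 0ℚ ≤ p → p ≤ 1ℚ → ∀ X Y →
                        Q.∣ discrepancy c p X Y ∣ ≤ ℕ→ℚ (∣ X ∣ ℕ.* ∣ Y ∣)
∣discrepancy∣≤∣X∣*∣Y∣ {c = c} 0≤p p≤1 X Y =
  ∣deviation∣≤ (eB c X Y) (∣ X ∣ ℕ.* ∣ Y ∣) 0≤p p≤1 (eB≤∣X∣*∣Y∣ c X Y)

∣discrepancy-∩∣≤∣B∣*N : ∀ {c : Coloring N} {p} → 0ℚ ≤ p → p ≤ 1ℚ → ∀ X B Y →
                        Q.∣ discrepancy c p (X ∩ B) Y ∣ ≤ ℕ→ℚ ∣ B ∣ * ℕ→ℚ N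
∣discrepancy-∩∣≤∣B∣*N {N} {c} {p} 0≤p p≤1 X B Y = begin
  Q.∣ discrepancy c p (X ∩ B) Y ∣  ≤⟨ ∣discrepancy∣≤∣X∣*∣Y∣ 0≤p p≤1 (X ∩ B) Y ⟩
  ℕ→ℚ (∣ X ∩ B ∣ ℕ.* ∣ Y ∣)        ≤⟨ ℕ→ℚ-mono-≤ (ℕₚ.*-mono-≤ ∣X∩B∣≤∣B∣ ∣Y∣≤N) ⟩
  ℕ→ℚ (∣ B ∣ ℕ.* N)                ≡⟨ ℕ→ℚ-* ∣ B ∣ N ⟩
  ℕ→ℚ ∣ B ∣ * ℕ→ℚ N                ∎
  where
  open ≤-Reasoning
  ∣X∩B∣≤∣B∣ : ∣ X ∩ B ∣ ℕ.≤ ∣ B ∣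
  ∣X∩B∣≤∣B∣ = Subsetₚ.p⊆q⇒∣p∣≤∣q∣ (Subsetₚ.p∩q⊆q X B)
  ∣Y∣≤N : ∣ Y ∣ ℕ.≤ N
  ∣Y∣≤N = Subsetₚ.∣p∣≤n Y

regular⇒∣discrepancy-∩∣≤ : ∀ {c : Coloring N} {p ε B} → RegularBlue c p ε B ⊤ →
  0ℚ ≤ p → p ≤ 1ℚ → 0ℚ ≤ ε → ∀ X Y →
  Q.∣ discrepancy c p (X ∩ B) Y ∣ ≤ ε * ℕ→ℚ N * ℕ→ℚ (∣ X ∩ B ∣ ℕ.+ ∣ B ∣)
regular⇒∣discrepancy-∩∣≤ {N} {ε = ε} {B} regular 0≤p p≤1 0≤ε X Y =
  regular-or-small⇒≤εN[x+a] (∣ X ∩ B ∣) (∣ Y ∣) (∣ B ∣) N 0≤ε (Subsetₚ.∣p∣≤n Y)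
    (∣discrepancy∣≤∣X∣*∣Y∣ 0≤p p≤1 (X ∩ B) Y)
    (λ large-x large-y → regular (X ∩ B) Y (Subsetₚ.p∩q⊆q X B) Subsetₚ.⊆⊤ large-x
       (subst (λ k → ε * ℕ→ℚ k ≤ ℕ→ℚ ∣ Y ∣) (sym (Subsetₚ.∣⊤∣≡n N)) large-y))

module _ {A : Fin ℓ → Subset N} {E : Subset N} (partition : IsPartition A E) where

  private
    disjoint = proj₁ partition
    separated = proj₁ (proj₂ partition)
    covering = proj₂ (proj₂ partition)

  when-partition : ∀ x v → v ≡ ∑[ i < ℓ ] when (lookup (A i) x) v ℕ.+ when (lookup E x) v
  when-partition x v with covering x
  ... | inj₁ x∈E rewrite []=⇒lookup x∈E = sym (cong (ℕ._+ v) (∑-≡0 _ (λ i → cong (λ b → when b v)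
          (∉⇒lookup≡false (λ x∈Ai → separated i x x∈Ai x∈E)))))
  ... | inj₂ (j , x∈Aj) rewrite ∉⇒lookup≡false (separated j x x∈Aj) = begin
    v                                         ≡⟨ cong (λ b → when b v) ([]=⇒lookup x∈Aj) ⟨
    when (lookup (A j) x) v                   ≡⟨ ∑-single _ j outside ⟨
    ∑[ i < ℓ ] when (lookup (A i) x) v        ≡⟨ ℕₚ.+-identityʳ _ ⟨
    ∑[ i < ℓ ] when (lookup (A i) x) v ℕ.+ 0  ∎
    where
    open ≡-Reasoning
    outside : ∀ i → i ≢ j → when (lookup (A i) x) v ≡ 0
    outside i i≢j = cong (λ b → when b v) (∉⇒lookup≡false (λ x∈Ai → i≢j (disjoint i j x x∈Ai x∈Aj)))

  ∑∈-partition : ∀ X (w : Fin N → ℕ) →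
                 ∑[ x ∈ X ] w x ≡ ∑[ i < ℓ ] ∑[ x ∈ X ∩ A i ] w x ℕ.+ ∑[ x ∈ X ∩ E ] w x
  ∑∈-partition X w = begin
    ∑[ x < N ] when (lookup X x) (w x)
      ≡⟨ sum-cong-≗ split ⟩
    ∑[ x < N ] (∑[ i < ℓ ] inA i x ℕ.+ inE x)
      ≡⟨ ∑-distrib-+ (λ x → ∑[ i < ℓ ] inA i x) inE ⟩
    ∑[ x < N ] ∑[ i < ℓ ] inA i x ℕ.+ ∑[ x < N ] inE x
      ≡⟨ cong (ℕ._+ ∑[ x < N ] inE x) (∑-comm (λ x i → inA i x)) ⟩
    ∑[ i < ℓ ] ∑[ x < N ] inA i x ℕ.+ ∑[ x < N ] inE x
      ∎
    where
    open ≡-Reasoning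
    inA : Fin ℓ → Fin N → ℕ
    inA i x = when (lookup (X ∩ A i) x) (w x)
    inE : Fin N → ℕ
    inE x = when (lookup (X ∩ E) x) (w x)
    split : ∀ x → when (lookup X x) (w x) ≡ ∑[ i < ℓ ] inA i x ℕ.+ inE x
    split x = begin
      X? (w x)
        ≡⟨ cong X? (when-partition x (w x)) ⟩
      X? (∑[ i < ℓ ] A? i (w x) ℕ.+ E? (w x))
        ≡⟨ when-+ (lookup X x) _ _ ⟩
      X? (∑[ i < ℓ ] A? i (w x)) ℕ.+ X? (E? (w x))
        ≡⟨ cong (ℕ._+ X? (E? (w x))) (∑-when (lookup X x) (λ i → A? i (w x))) ⟨
      ∑[ i < ℓ ] X? (A? i (w x)) ℕ.+ X? (E? (w x))
        ≡⟨ cong₂ ℕ._+_ (sum-cong-≗ (λ i → when-∩ X (A i) x (w x))) (when-∩ X E x (w x)) ⟨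
      ∑[ i < ℓ ] inA i x ℕ.+ inE x
        ∎
      where
      X? E? : ℕ → ℕ
      X? = when (lookup X x)
      E? = when (lookup E x)
      A? : Fin ℓ → ℕ → ℕ
      A? i = when (lookup (A i) x)

  card-partition : ∀ X → ∣ X ∣ ≡ ∑[ i < ℓ ] ∣ X ∩ A i ∣ ℕ.+ ∣ X ∩ E ∣
  card-partition X = begin
    ∣ X ∣
      ≡⟨ card≡∑∈1 X ⟩
    ∑[ x ∈ X ] 1
      ≡⟨ ∑∈-partition X (λ _ → 1) ⟩
    ∑[ i < ℓ ] ∑[ x ∈ X ∩ A i ] 1 ℕ.+ ∑[ x ∈ X ∩ E ] 1
      ≡⟨ cong₂ ℕ._+_ (sum-cong-≗ (λ i → card≡∑∈1 (X ∩ A i))) (card≡∑∈1 (X ∩ E)) ⟨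
    ∑[ i < ℓ ] ∣ X ∩ A i ∣ ℕ.+ ∣ X ∩ E ∣
      ∎
    where open ≡-Reasoning

  eB-partition : (c : Coloring N) (X Y : Subset N) →
                 eB c X Y ≡ ∑[ i < ℓ ] eB c (X ∩ A i) Y ℕ.+ eB c (X ∩ E) Y
  eB-partition c X Y = begin
    eB c X Y
      ≡⟨ eB≡∑∈∑∈blueEdge c X Y ⟩
    ∑[ x ∈ X ] deg x
      ≡⟨ ∑∈-partition X deg ⟩
    ∑[ i < ℓ ] ∑[ x ∈ X ∩ A i ] deg x ℕ.+ ∑[ x ∈ X ∩ E ] deg x
      ≡⟨ cong₂ ℕ._+_ (sum-cong-≗ (λ i → eB≡∑∈∑∈blueEdge c (X ∩ A i) Y)) (eB≡∑∈∑∈blueEdge c (X ∩ E) Y) ⟨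
    ∑[ i < ℓ ] eB c (X ∩ A i) Y ℕ.+ eB c (X ∩ E) Y
      ∎
    where
    open ≡-Reasoning
    deg : Fin N → ℕ
    deg x = ∑[ y ∈ Y ] blueEdge c x y

  discrepancy-partition : (c : Coloring N) (p : ℚ) (X Y : Subset N) →
    discrepancy c p X Y ≡ ∑ℚ (λ i → discrepancy c p (X ∩ A i) Y) + discrepancy c p (X ∩ E) Y
  discrepancy-partition c p X Y = begin
    deviation p (eB c X Y) (∣ X ∣ ℕ.* ∣ Y ∣)
      ≡⟨ cong₂ (deviation p) (eB-partition c X Y) pairs-partition ⟩
    deviation p (∑[ i < ℓ ] e i ℕ.+ eB c (X ∩ E) Y) (∑[ i < ℓ ] m i ℕ.+ ∣ X ∩ E ∣ ℕ.* ∣ Y ∣)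
      ≡⟨ deviation-+ p (∑[ i < ℓ ] e i) (eB c (X ∩ E) Y) (∑[ i < ℓ ] m i) (∣ X ∩ E ∣ ℕ.* ∣ Y ∣) ⟩
    deviation p (∑[ i < ℓ ] e i) (∑[ i < ℓ ] m i) + discrepancy c p (X ∩ E) Y
      ≡⟨ cong (_+ discrepancy c p (X ∩ E) Y) (deviation-∑ p e m) ⟩
    ∑ℚ (λ i → discrepancy c p (X ∩ A i) Y) + discrepancy c p (X ∩ E) Y
      ∎
    where
    open ≡-Reasoning
    e m : Fin ℓ → ℕ
    e i = eB c (X ∩ A i) Y
    m i = ∣ X ∩ A i ∣ ℕ.* ∣ Y ∣
    pairs-partition : ∣ X ∣ ℕ.* ∣ Y ∣ ≡ ∑[ i < ℓ ] m i ℕ.+ ∣ X ∩ E ∣ ℕ.* ∣ Y ∣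
    pairs-partition = begin
      ∣ X ∣ ℕ.* ∣ Y ∣
        ≡⟨ cong (ℕ._* ∣ Y ∣) (card-partition X) ⟩
      (∑[ i < ℓ ] ∣ X ∩ A i ∣ ℕ.+ ∣ X ∩ E ∣) ℕ.* ∣ Y ∣
        ≡⟨ ℕₚ.*-distribʳ-+ (∣ Y ∣) (∑[ i < ℓ ] ∣ X ∩ A i ∣) (∣ X ∩ E ∣) ⟩
      ∑[ i < ℓ ] ∣ X ∩ A i ∣ ℕ.* ∣ Y ∣ ℕ.+ ∣ X ∩ E ∣ ℕ.* ∣ Y ∣
        ≡⟨ cong (ℕ._+ ∣ X ∩ E ∣ ℕ.* ∣ Y ∣) (*-distribʳ-sum (∣ Y ∣) (λ i → ∣ X ∩ A i ∣)) ⟩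
      ∑[ i < ℓ ] m i ℕ.+ ∣ X ∩ E ∣ ℕ.* ∣ Y ∣
        ∎

  ∑∣X∩A∣≤∣X∣ : ∀ X → ∑[ i < ℓ ] ∣ X ∩ A i ∣ ℕ.≤ ∣ X ∣
  ∑∣X∩A∣≤∣X∣ X = ℕₚ.≤-trans (ℕₚ.m≤m+n (∑[ i < ℓ ] ∣ X ∩ A i ∣) (∣ X ∩ E ∣))
                            (ℕₚ.≤-reflexive (sym (card-partition X)))

  ∑∣A∣≤N : ∑[ i < ℓ ] ∣ A i ∣ ℕ.≤ N
  ∑∣A∣≤N = begin
    ∑[ i < ℓ ] ∣ A i ∣      ≡⟨ sum-cong-≗ (λ i → cong ∣_∣ (Subsetₚ.∩-identityˡ (A i))) ⟨
    ∑[ i < ℓ ] ∣ ⊤ ∩ A i ∣  ≤⟨ ∑∣X∩A∣≤∣X∣ ⊤ ⟩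
    ∣ ⊤ {N} ∣               ≡⟨ Subsetₚ.∣⊤∣≡n N ⟩
    N                       ∎
    where open ℕₚ.≤-Reasoning

  ∑[∣X∩A∣+∣A∣]≤N+N : ∀ X → ∑[ i < ℓ ] (∣ X ∩ A i ∣ ℕ.+ ∣ A i ∣) ℕ.≤ N ℕ.+ N
  ∑[∣X∩A∣+∣A∣]≤N+N X = begin
    ∑[ i < ℓ ] (∣ X ∩ A i ∣ ℕ.+ ∣ A i ∣)
      ≡⟨ ∑-distrib-+ (λ i → ∣ X ∩ A i ∣) (λ i → ∣ A i ∣) ⟩
    ∑[ i < ℓ ] ∣ X ∩ A i ∣ ℕ.+ ∑[ i < ℓ ] ∣ A i ∣
      ≤⟨ ℕₚ.+-mono-≤ (ℕₚ.≤-trans (∑∣X∩A∣≤∣X∣ X) (Subsetₚ.∣p∣≤n X)) ∑∣A∣≤N ⟩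
    N ℕ.+ N
      ∎
    where open ℕₚ.≤-Reasoning

  regular-partition⇒∣discrepancy∣≤3εN² : ∀ {c : Coloring N} {p ε} → 0ℚ ≤ p → p ≤ 1ℚ → 0ℚ ≤ ε →
    (∀ i → RegularBlue c p ε (A i) ⊤) → ℕ→ℚ ∣ E ∣ ≤ ε * ℕ→ℚ N →
    ∀ X Y → Q.∣ discrepancy c p X Y ∣ ≤ (ε + ε + ε) * ℕ→ℚ (N ℕ.* N)
  regular-partition⇒∣discrepancy∣≤3εN² {c} {p} {ε} 0≤p p≤1 0≤ε regular small-E X Y = begin
    Q.∣ discrepancy c p X Y ∣
      ≡⟨ cong Q.∣_∣ (discrepancy-partition c p X Y) ⟩
    Q.∣ ∑ℚ D + D-E ∣
      ≤⟨ ∣p+q∣≤∣p∣+∣q∣ (∑ℚ D) D-E ⟩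
    Q.∣ ∑ℚ D ∣ + Q.∣ D-E ∣
      ≤⟨ +-mono-≤ (∣∑ℚ∣≤ D _ ∣D∣≤) ∣D-E∣≤ ⟩
    ∑ℚ (λ i → ε * n * ℕ→ℚ (k i)) + ε * n * n
      ≡⟨ ∑ℚ-*ℕ→ℚ (ε * n) k N ⟩
    ε * n * ℕ→ℚ (∑[ i < ℓ ] k i ℕ.+ N)
      ≤⟨ *-monoˡ-≤-nonNeg (ε * n) {{εn-nonNeg}} (ℕ→ℚ-mono-≤ (ℕₚ.+-monoˡ-≤ N (∑[∣X∩A∣+∣A∣]≤N+N X))) ⟩
    ε * n * ℕ→ℚ (N ℕ.+ N ℕ.+ N)
      ≡⟨ cong (ε * n *_) (trans (ℕ→ℚ-+ (N ℕ.+ N) N) (cong (_+ n) (ℕ→ℚ-+ N N))) ⟩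
    ε * n * (n + n + n)
      ≡⟨ solve 2 (λ ε n → ε :* n :* (n :+ n :+ n) := (ε :+ ε :+ ε) :* (n :* n)) refl ε n ⟩
    (ε + ε + ε) * (n * n)
      ≡⟨ cong ((ε + ε + ε) *_) (ℕ→ℚ-* N N) ⟨
    (ε + ε + ε) * ℕ→ℚ (N ℕ.* N)
      ∎
    where
    open ≤-Reasoning
    open +-*-Solver
    n : ℚ
    n = ℕ→ℚ N
    D : Fin ℓ → ℚ
    D i = discrepancy c p (X ∩ A i) Y
    D-E : ℚ
    D-E = discrepancy c p (X ∩ E) Y
    k : Fin ℓ → ℕ
    k i = ∣ X ∩ A i ∣ ℕ.+ ∣ A i ∣
    εn-nonNeg : NonNegative (ε * n)
    εn-nonNeg = nonNeg*nonNeg⇒nonNeg ε {{nonNegative 0≤ε}} n {{ℕ→ℚ-nonNeg N}}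
    ∣D∣≤ : ∀ i → Q.∣ D i ∣ ≤ ε * n * ℕ→ℚ (k i)
    ∣D∣≤ i = regular⇒∣discrepancy-∩∣≤ (regular i) 0≤p p≤1 0≤ε X Y
    ∣D-E∣≤ : Q.∣ D-E ∣ ≤ ε * n * n
    ∣D-E∣≤ = ≤-trans (∣discrepancy-∩∣≤∣B∣*N 0≤p p≤1 X E Y)
                     (*-monoʳ-≤-nonNeg n {{ℕ→ℚ-nonNeg N}} small-E)

quasirandom-on-no-vertices : (c : Coloring 0) (p θ : ℚ) → Quasirandom c p θ
quasirandom-on-no-vertices c p θ [] [] _ =
  subst₂ _≤_ (cong (λ q → Q.∣ 0ℚ - q ∣) (sym (*-zeroʳ p))) (sym (*-zeroʳ θ)) ≤-refl

-- For N = 0 the hypothesis |E| ≤ εN does not give ε ≥ 0, but then all discrepancies vanish.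
lemma5p5 : (N : ℕ) (c : Coloring N) → Symmetric c →
           (p θ ε : ℚ) → 0ℚ < p → p < 1ℚ → 0ℚ < θ → ε ≤ θ * (+ 1 / 3) →
           (ℓ : ℕ) (A : Fin ℓ → Subset N) (E : Subset N) → IsPartition A E →
           ((i : Fin ℓ) → RegularBlue c p ε (A i) ⊤) →
           ℕ→ℚ ∣ E ∣ ≤ ε * ℕ→ℚ N →
           Quasirandom c p θ
lemma5p5 ℕ.zero c _ p θ _ _ _ _ _ _ _ _ _ _ _ = quasirandom-on-no-vertices c p θ
lemma5p5 N@(ℕ.suc _) c _ p θ ε 0<p p<1 _ ε≤θ/3 ℓ A E partition regular small-E X Y _ =
  ≤-trans (regular-partition⇒∣discrepancy∣≤3εN² partition 0≤p p≤1 0≤ε regular small-E X Y)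
          (*-monoʳ-≤-nonNeg (ℕ→ℚ (N ℕ.* N)) {{ℕ→ℚ-nonNeg (N ℕ.* N)}} (ε≤θ/3⇒ε+ε+ε≤θ {ε} {θ} ε≤θ/3))
  where
  0≤p : 0ℚ ≤ p
  0≤p = <⇒≤ 0<p
  p≤1 : p ≤ 1ℚ
  p≤1 = <⇒≤ p<1
  0≤ε : 0ℚ ≤ ε
  0≤ε = *-cancelʳ-≤-pos (ℕ→ℚ N) {{normalize-pos N 1}}
          (subst (_≤ ε * ℕ→ℚ N) (sym (*-zeroˡ (ℕ→ℚ N))) (≤-trans (0≤ℕ→ℚ ∣ E ∣) small-E))
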